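{- Let $J_\pm(n,2,-1)$ be the graph whose vertex set consists of all vectors $v\in\{ -1,0,1\}^n$ with exactly $2$ nonzero coordinates (i.e. of Euclidean length $\sqrt{2}$), two vertices being adjacent if and only if their standard scalar product equals $-1$. Then for all integers $n\ge 2$, \[ \log_2 n \;\le\; \chi\big(J_\pm(n,2,-1)\big) \;\le\; \log_2 n + \left(\tfrac12 + o(1)\right)\log_2\log_2 n, \] where $\chi$ denotes the chromatic number and $o(1)$ denotes a quantity tending to $0$ as $n\to\infty$.
   Context: The chromatic number $\chi(G)$ of a graph $G$ is the minimum number of colors in a coloring of the vertices such that adjacent vertices receive different colors. -}

module Defs where

open import Data.Nat using (ℕ; zero; suc; _+_; _*_; _^_; _≤_; _<_)
open import Data.Integer as ℤ using (ℤ; 0ℤ; 1ℤ; -1ℤ)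
open import Data.Fin using (Fin)
open import Data.List using (List; map; filter; length; allFin; foldr)
open import Data.Product using (Σ; _×_; _,_; proj₁; ∃-syntax)
open import Data.Sum using (_⊎_)
open import Relation.Binary.PropositionalEquality using (_≡_; _≢_)
open import Relation.Nullary.Decidable using (¬?)

sumℤ : List ℤ → ℤ
sumℤ = foldr ℤ._+_ 0ℤ

dot : {n : ℕ} → (Fin n → ℤ) → (Fin n → ℤ) → ℤ
dot {n} u v = sumℤ (map (λ i → u i ℤ.* v i) (allFin n))

nnz : {n : ℕ} → (Fin n → ℤ) → ℕ
nnz {n} v = length (filter (λ i → ¬? (v i ℤ.≟ 0ℤ)) (allFin n))

IsVertex : {n : ℕ} → (Fin n → ℤ) → Set
IsVertex {n} v = (∀ i → (v i ≡ -1ℤ) ⊎ (v i ≡ 0ℤ) ⊎ (v i ≡ 1ℤ)) × (nnz v ≡ 2)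

Vertex : ℕ → Set
Vertex n = Σ (Fin n → ℤ) IsVertex

Adj : {n : ℕ} → Vertex n → Vertex n → Set
Adj u v = dot (proj₁ u) (proj₁ v) ≡ -1ℤ

Colorable : ℕ → ℕ → Set
Colorable n k = Σ (Vertex n → Fin k) λ c → ∀ u v → Adj u v → c u ≢ c v

IsChromaticNumber : ℕ → ℕ → Set
IsChromaticNumber n k = Colorable n k × (∀ j → Colorable n j → k ≤ j)

-- For n ≥ 2, k, and rational c = a/b (b ≥ 1), the real inequality
--   k ≤ log₂ n + (a/b) · log₂ (log₂ n)
-- written out exactly over ℕ.  It is equivalent to
--   (log₂ n)^a ≥ r,  r = 2^(k b) / n^b,
-- i.e. every rational t = m/d ≥ 0 (d ≥ 1) with t^a < r satisfies t ≤ log₂ n,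
-- i.e. 2^m ≤ n^d.
UpperBound : (n k a b : ℕ) → Set
UpperBound n k a b =
  ∀ m d → 1 ≤ d → (m ^ a) * (n ^ b) < (2 ^ (k * b)) * (d ^ a) → 2 ^ m ≤ n ^ d

module Submission where

-- Lower bound: for i < j < l the vertices e_i − e_j and e_j − e_l are adjacent, so a proper
-- colouring colours the shift graph on {1,…,n}.  There the colour of the edge j → l lies in
-- the set of colours of edges entering l but not in the one for j, so these n sets are
-- distinct and n ≤ 2^χ.
--
-- Upper bound: give the coordinates distinct w-subsets A_i of {1,…,2w}, possible when
-- n ≤ C(2w,w).  A vertex with +1 at i and −1 at j gets a colour in A_i ∖ A_j (nonempty, as
-- equal-size sets form an antichain), vertices without −1 resp. +1 entries get two extra
-- colours.  Adjacent vertices have a coordinate of opposite signs, so this is proper and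
-- χ ≤ 2w + 2.  Since C(2w,w) ≥ 4^w / (2√w), the least such w gives
-- χ ≤ log₂ n + ½ log₂ log₂ n + O(1).

open import Defs
open import Data.Nat as ℕ using (ℕ; zero; suc; _+_; _*_; _^_; _≤_; _<_; z≤n; s≤s)
open import Data.Integer as ℤ using (ℤ; 0ℤ; 1ℤ; -1ℤ)
import Data.Integer.Properties as ℤ
import Data.Nat.Properties as ℕ
open import Data.Fin as Fin using (Fin; zero; suc)
import Data.Fin.Properties as Fin
open import Data.List using (List; []; _∷_; filter; length; tabulate)
open import Data.List.Properties using (map-tabulate; filter-accept; filter-reject)
import Data.List.Membership.Propositional as List
open import Data.List.Membership.Propositional.Properties using (∈-filter⁺; ∈-allFin)
import Data.List.Relation.Unary.Any as Any
open import Data.Vec using (_∷_; []; here; there)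
open import Data.Vec.Properties using (∷-injectiveʳ)
open import Data.Fin.Subset using (Subset; inside; outside; ∣_∣; _∈_; _∉_; _⊈_) renaming (⊥ to ∅)
open import Data.Fin.Subset.Properties using (_∈?_; _⊆?_; ⊆-antisym; p⊂q⇒∣p∣<∣q∣; ∣⊥∣≡0)
open import Data.Nat.Combinatorics using (_C_; nCk+nC[k+1]≡[n+1]C[k+1]; nCk≡nC[n∸k])
open import Data.Nat.Tactic.RingSolver using (solve-∀)
open import Data.Product using (Σ; _×_; _,_; proj₁; proj₂; ∃; ∃₂; ∃-syntax; uncurry)
open import Data.Sum using (_⊎_; inj₁; inj₂; [_,_]′)
open import Data.Empty using (⊥-elim)
open import Function using (_∘_; case_of_)
open import Relation.Binary.PropositionalEquality
open import Relation.Nullary using (¬_; Dec; yes; no; contradiction)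
open import Relation.Nullary.Decidable using (¬?; _×-dec_; _⊎-dec_; decidable-stable)
open import Relation.Unary using (Decidable)

sumℤ-tabulate-zero : ∀ {n} (f : Fin n → ℤ) → (∀ k → f k ≡ 0ℤ) → sumℤ (tabulate f) ≡ 0ℤ
sumℤ-tabulate-zero {zero}  f f≡0 = refl
sumℤ-tabulate-zero {suc n} f f≡0 =
  cong₂ ℤ._+_ (f≡0 zero) (sumℤ-tabulate-zero (f ∘ suc) (f≡0 ∘ suc))

sumℤ-tabulate-single : ∀ {n} (f : Fin n → ℤ) (p : Fin n) →
                       (∀ k → k ≢ p → f k ≡ 0ℤ) → sumℤ (tabulate f) ≡ f p
sumℤ-tabulate-single {suc n} f zero f≡0 = begin
  f zero ℤ.+ sumℤ (tabulate (f ∘ suc))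
    ≡⟨ cong (λ s → f zero ℤ.+ s) (sumℤ-tabulate-zero (f ∘ suc) (λ k → f≡0 (suc k) λ ())) ⟩
  f zero ℤ.+ 0ℤ
    ≡⟨ ℤ.+-identityʳ (f zero) ⟩
  f zero
    ∎
  where open ≡-Reasoning
sumℤ-tabulate-single {suc n} f (suc p) f≡0 = begin
  f zero ℤ.+ sumℤ (tabulate (f ∘ suc))
    ≡⟨ cong₂ ℤ._+_ (f≡0 zero λ ())
                   (sumℤ-tabulate-single (f ∘ suc) p λ k k≢p → f≡0 (suc k) (k≢p ∘ Fin.suc-injective)) ⟩
  0ℤ ℤ.+ f (suc p)
    ≡⟨ ℤ.+-identityˡ (f (suc p)) ⟩
  f (suc p)
    ∎
  where open ≡-Reasoning

sumℤ-tabulate-nonneg : ∀ {n} (f : Fin n → ℤ) → (∀ k → 0ℤ ℤ.≤ f k) → 0ℤ ℤ.≤ sumℤ (tabulate f)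
sumℤ-tabulate-nonneg {zero}  f f≥0 = ℤ.≤-refl
sumℤ-tabulate-nonneg {suc n} f f≥0 = ℤ.+-mono-≤ (f≥0 zero) (sumℤ-tabulate-nonneg (f ∘ suc) (f≥0 ∘ suc))

dot≡sumℤ-tabulate : ∀ {n} (u v : Fin n → ℤ) → dot u v ≡ sumℤ (tabulate λ i → u i ℤ.* v i)
dot≡sumℤ-tabulate u v = cong sumℤ (map-tabulate (λ i → i) (λ i → u i ℤ.* v i))

module _ {a p} {A : Set a} {P : A → Set p} (P? : Decidable P) where

  length-filter-tabulate-none : ∀ {m} (g : Fin m → A) → (∀ k → ¬ P (g k)) →
                                length (filter P? (tabulate g)) ≡ 0
  length-filter-tabulate-none {zero}  g ¬P = refl
  length-filter-tabulate-none {suc m} g ¬P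
    rewrite filter-reject P? {xs = tabulate (g ∘ suc)} (¬P zero) =
    length-filter-tabulate-none (g ∘ suc) (¬P ∘ suc)

  length-filter-tabulate-single : ∀ {m} (g : Fin m → A) (i : Fin m) → P (g i) →
                                  (∀ k → k ≢ i → ¬ P (g k)) →
                                  length (filter P? (tabulate g)) ≡ 1
  length-filter-tabulate-single {suc m} g zero Pi ¬P
    rewrite filter-accept P? {xs = tabulate (g ∘ suc)} Pi =
    cong suc (length-filter-tabulate-none (g ∘ suc) (λ k → ¬P (suc k) λ ()))
  length-filter-tabulate-single {suc m} g (suc i) Pi ¬P
    rewrite filter-reject P? {xs = tabulate (g ∘ suc)} (¬P zero λ ()) =
    length-filter-tabulate-single (g ∘ suc) i Pi (λ k k≢i → ¬P (suc k) (k≢i ∘ Fin.suc-injective))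

  length-filter-tabulate-pair : ∀ {m} (g : Fin m → A) (i j : Fin m) → i ≢ j → P (g i) → P (g j) →
                                (∀ k → k ≢ i → k ≢ j → ¬ P (g k)) →
                                length (filter P? (tabulate g)) ≡ 2
  length-filter-tabulate-pair {suc m} g zero zero i≢j _ _ _ = ⊥-elim (i≢j refl)
  length-filter-tabulate-pair {suc m} g zero (suc j) _ Pi Pj ¬P
    rewrite filter-accept P? {xs = tabulate (g ∘ suc)} Pi =
    cong suc (length-filter-tabulate-single (g ∘ suc) j Pj
      (λ k k≢j → ¬P (suc k) (λ ()) (k≢j ∘ Fin.suc-injective)))
  length-filter-tabulate-pair {suc m} g (suc i) zero _ Pi Pj ¬P
    rewrite filter-accept P? {xs = tabulate (g ∘ suc)} Pj =
    cong suc (length-filter-tabulate-single (g ∘ suc) i Pi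
      (λ k k≢i → ¬P (suc k) (k≢i ∘ Fin.suc-injective) (λ ())))
  length-filter-tabulate-pair {suc m} g (suc i) (suc j) i≢j Pi Pj ¬P
    rewrite filter-reject P? {xs = tabulate (g ∘ suc)} (¬P zero (λ ()) (λ ())) =
    length-filter-tabulate-pair (g ∘ suc) i j (i≢j ∘ cong suc) Pi Pj
      (λ k k≢i k≢j → ¬P (suc k) (k≢i ∘ Fin.suc-injective) (k≢j ∘ Fin.suc-injective))

IsTrit : ℤ → Set
IsTrit x = (x ≡ -1ℤ) ⊎ (x ≡ 0ℤ) ⊎ (x ≡ 1ℤ)

Opposite : ℤ → ℤ → Set
Opposite x y = (x ≡ 1ℤ × y ≡ -1ℤ) ⊎ (x ≡ -1ℤ × y ≡ 1ℤ)

opposite? : ∀ x y → Dec (Opposite x y)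
opposite? x y = ((x ℤ.≟ 1ℤ) ×-dec (y ℤ.≟ -1ℤ)) ⊎-dec ((x ℤ.≟ -1ℤ) ×-dec (y ℤ.≟ 1ℤ))

trit-*-nonneg : ∀ {x y} → IsTrit x → IsTrit y → ¬ Opposite x y → 0ℤ ℤ.≤ x ℤ.* y
trit-*-nonneg (inj₁ refl)        (inj₁ refl)        _   = ℤ.+≤+ z≤n
trit-*-nonneg (inj₁ refl)        (inj₂ (inj₁ refl)) _   = ℤ.+≤+ z≤n
trit-*-nonneg (inj₁ refl)        (inj₂ (inj₂ refl)) ¬op = ⊥-elim (¬op (inj₂ (refl , refl)))
trit-*-nonneg (inj₂ (inj₁ refl)) _                  _   = ℤ.+≤+ z≤n
trit-*-nonneg (inj₂ (inj₂ refl)) (inj₁ refl)        ¬op = ⊥-elim (¬op (inj₁ (refl , refl)))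
trit-*-nonneg (inj₂ (inj₂ refl)) (inj₂ (inj₁ refl)) _   = ℤ.+≤+ z≤n
trit-*-nonneg (inj₂ (inj₂ refl)) (inj₂ (inj₂ refl)) _   = ℤ.+≤+ z≤n

-- Without a coordinate of opposite signs every term of the scalar product is ≥ 0.
dot≡-1⇒opposite : ∀ {n} (u v : Fin n → ℤ) → (∀ i → IsTrit (u i)) → (∀ i → IsTrit (v i)) →
                  dot u v ≡ -1ℤ → ∃ λ i → Opposite (u i) (v i)
dot≡-1⇒opposite u v u-trit v-trit u·v≡-1 with Fin.any? (λ i → opposite? (u i) (v i))
... | yes opposite = opposite
... | no ¬opposite
  with subst (0ℤ ℤ.≤_) (trans (sym (dot≡sumℤ-tabulate u v)) u·v≡-1)
         (sumℤ-tabulate-nonneg _ λ i → trit-*-nonneg (u-trit i) (v-trit i) (¬opposite ∘ (i ,_)))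
... | ()

length≡2⇒⊆pair : ∀ {a} {A : Set a} (xs : List A) → length xs ≡ 2 →
                 ∃₂ λ x y → ∀ {z} → z List.∈ xs → z ≡ x ⊎ z ≡ y
length≡2⇒⊆pair (x ∷ y ∷ []) refl = x , y , λ where
  (Any.here z≡x)             → inj₁ z≡x
  (Any.there (Any.here z≡y)) → inj₂ z≡y

among-pair : ∀ {a} {A : Set a} {x y i j k : A} → i ≡ x ⊎ i ≡ y → j ≡ x ⊎ j ≡ y → i ≢ j →
             k ≡ x ⊎ k ≡ y → k ≡ i ⊎ k ≡ j
among-pair (inj₁ refl) (inj₁ refl) i≢j _           = ⊥-elim (i≢j refl)
among-pair (inj₂ refl) (inj₂ refl) i≢j _           = ⊥-elim (i≢j refl)
among-pair (inj₁ refl) (inj₂ refl) _   (inj₁ refl) = inj₁ refl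
among-pair (inj₁ refl) (inj₂ refl) _   (inj₂ refl) = inj₂ refl
among-pair (inj₂ refl) (inj₁ refl) _   (inj₁ refl) = inj₂ refl
among-pair (inj₂ refl) (inj₁ refl) _   (inj₂ refl) = inj₁ refl

nnz≡2⇒support⊆pair : ∀ {n} (v : Fin n → ℤ) → nnz v ≡ 2 →
                     ∃₂ λ a b → ∀ k → v k ≢ 0ℤ → k ≡ a ⊎ k ≡ b
nnz≡2⇒support⊆pair v nnz≡2 with length≡2⇒⊆pair _ nnz≡2
... | a , b , ⊆ab = a , b , λ k vk≢0 → ⊆ab (∈-filter⁺ (λ i → ¬? (v i ℤ.≟ 0ℤ)) (∈-allFin k) vk≢0)

≡1⇒≢0 : ∀ {x} → x ≡ 1ℤ → x ≢ 0ℤ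
≡1⇒≢0 refl ()

≡-1⇒≢0 : ∀ {x} → x ≡ -1ℤ → x ≢ 0ℤ
≡-1⇒≢0 refl ()

≡1⇒≢-1 : ∀ {x} → x ≡ 1ℤ → x ≢ -1ℤ
≡1⇒≢-1 refl ()

vertex-signs : ∀ {n} {v : Fin n → ℤ} {i j} → IsVertex v → v i ≡ 1ℤ → v j ≡ -1ℤ →
               (∀ k → v k ≡ 1ℤ → k ≡ i) × (∀ k → v k ≡ -1ℤ → k ≡ j)
vertex-signs {v = v} {i} {j} (_ , nnz≡2) vi≡1 vj≡-1 = positive , negative
  where
  support = proj₂ (proj₂ (nnz≡2⇒support⊆pair v nnz≡2))

  i≢j : i ≢ j
  i≢j refl = ≡1⇒≢-1 vi≡1 vj≡-1

  i-or-j : ∀ k → v k ≢ 0ℤ → k ≡ i ⊎ k ≡ j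
  i-or-j k vk≢0 = among-pair (support i (≡1⇒≢0 vi≡1)) (support j (≡-1⇒≢0 vj≡-1)) i≢j (support k vk≢0)

  positive : ∀ k → v k ≡ 1ℤ → k ≡ i
  positive k vk≡1 with i-or-j k (≡1⇒≢0 vk≡1)
  ... | inj₁ k≡i  = k≡i
  ... | inj₂ refl = ⊥-elim (≡1⇒≢-1 vk≡1 vj≡-1)

  negative : ∀ k → v k ≡ -1ℤ → k ≡ j
  negative k vk≡-1 with i-or-j k (≡-1⇒≢0 vk≡-1)
  ... | inj₁ refl = ⊥-elim (≡1⇒≢-1 vi≡1 vk≡-1)
  ... | inj₂ k≡j  = k≡j

shift : ∀ {n} → Fin n → Fin n → Fin n → ℤ
shift i j k with k Fin.≟ i | k Fin.≟ j
... | yes _ | _     = 1ℤ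
... | no _  | yes _ = -1ℤ
... | no _  | no _  = 0ℤ

shift-trit : ∀ {n} (i j k : Fin n) → IsTrit (shift i j k)
shift-trit i j k with k Fin.≟ i | k Fin.≟ j
... | yes _ | _     = inj₂ (inj₂ refl)
... | no _  | yes _ = inj₁ refl
... | no _  | no _  = inj₂ (inj₁ refl)

shift-at-i : ∀ {n} (i j : Fin n) → shift i j i ≡ 1ℤ
shift-at-i i j with i Fin.≟ i
... | yes _  = refl
... | no i≢i = ⊥-elim (i≢i refl)

shift-at-j : ∀ {n} {i j : Fin n} → i ≢ j → shift i j j ≡ -1ℤ
shift-at-j {i = i} {j} i≢j with j Fin.≟ i | j Fin.≟ j
... | yes j≡i | _      = ⊥-elim (i≢j (sym j≡i))
... | no _    | yes _  = refl
... | no _    | no j≢j = ⊥-elim (j≢j refl)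

shift-elsewhere : ∀ {n} {i j k : Fin n} → k ≢ i → k ≢ j → shift i j k ≡ 0ℤ
shift-elsewhere {i = i} {j} {k} k≢i k≢j with k Fin.≟ i | k Fin.≟ j
... | yes k≡i | _       = ⊥-elim (k≢i k≡i)
... | no _    | yes k≡j = ⊥-elim (k≢j k≡j)
... | no _    | no _    = refl

shift-nnz : ∀ {n} {i j : Fin n} → i ≢ j → nnz (shift i j) ≡ 2
shift-nnz {i = i} {j} i≢j =
  length-filter-tabulate-pair (λ k → ¬? (shift i j k ℤ.≟ 0ℤ)) (λ k → k) i j i≢j
    (≡1⇒≢0 (shift-at-i i j)) (≡-1⇒≢0 (shift-at-j i≢j))
    (λ k k≢i k≢j shift≢0 → shift≢0 (shift-elsewhere k≢i k≢j))

shiftVertex : ∀ {n} {i j : Fin n} → i Fin.< j → Vertex n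
shiftVertex {i = i} {j} i<j = shift i j , shift-trit i j , shift-nnz (Fin.<⇒≢ i<j)

shiftVertex-adjacent : ∀ {n} {i j l : Fin n} (i<j : i Fin.< j) (j<l : j Fin.< l) →
                       Adj (shiftVertex i<j) (shiftVertex j<l)
shiftVertex-adjacent {i = i} {j} {l} i<j j<l = begin
  dot (shift i j) (shift j l)                        ≡⟨ dot≡sumℤ-tabulate (shift i j) (shift j l) ⟩
  sumℤ (tabulate λ k → shift i j k ℤ.* shift j l k) ≡⟨ sumℤ-tabulate-single _ j vanishes ⟩
  shift i j j ℤ.* shift j l j                        ≡⟨ cong₂ ℤ._*_ (shift-at-j (Fin.<⇒≢ i<j)) (shift-at-i j l) ⟩
  -1ℤ                                                ∎
  where
  open ≡-Reasoning

  i≢l : i ≢ l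
  i≢l = Fin.<⇒≢ (Fin.<-trans i<j j<l)

  vanishes : ∀ k → k ≢ j → shift i j k ℤ.* shift j l k ≡ 0ℤ
  vanishes k k≢j = case k Fin.≟ i of λ where
    (yes k≡i) → trans (cong (shift i j k ℤ.*_) (shift-elsewhere k≢j (i≢l ∘ trans (sym k≡i))))
                      (ℤ.*-zeroʳ (shift i j k))
    (no k≢i)  → cong (ℤ._* shift j l k) (shift-elsewhere k≢i k≢j)

funToFin-injective : ∀ {m n} {f g : Fin m → Fin n} → Fin.funToFin f ≡ Fin.funToFin g → ∀ x → f x ≡ g x
funToFin-injective {f = f} {g} same x = begin
  f x                                ≡⟨ Fin.finToFun-funToFin f x ⟨
  Fin.finToFun (Fin.funToFin f) x    ≡⟨ cong (λ code → Fin.finToFun code x) same ⟩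
  Fin.finToFun (Fin.funToFin g) x    ≡⟨ Fin.finToFun-funToFin g x ⟩
  g x                                ∎
  where open ≡-Reasoning

shift-colouring-bound : ∀ {n k} (c : ∀ {i j : Fin n} → i Fin.< j → Fin k) →
                        (∀ {i j l} (i<j : i Fin.< j) (j<l : j Fin.< l) → c i<j ≢ c j<l) →
                        n ≤ 2 ^ k
shift-colouring-bound {n} {k} c proper = ℕ.≮⇒≥ no-collision
  where
  incoming-from? : ∀ j x i → Dec (Σ (i Fin.< j) λ i<j → c i<j ≡ x)
  incoming-from? j x i with i Fin.<? j
  ... | no i≮j = no (i≮j ∘ proj₁)
  ... | yes i<j with c i<j Fin.≟ x
  ...   | yes c≡x = yes (i<j , c≡x)
  ...   | no c≢x  = no λ (i<j′ , c≡x) → c≢x (subst (λ lt → c lt ≡ x) (Fin.<-irrelevant i<j′ i<j) c≡x)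

  incoming : Fin n → Fin k → Fin 2
  incoming j x with Fin.any? (incoming-from? j x)
  ... | yes _ = suc zero
  ... | no _  = zero

  incoming-target : ∀ {j l} (j<l : j Fin.< l) → incoming l (c j<l) ≡ suc zero
  incoming-target {j} {l} j<l with Fin.any? (incoming-from? l (c j<l))
  ... | yes _        = refl
  ... | no ¬incoming = ⊥-elim (¬incoming (j , j<l , refl))

  incoming-source : ∀ {j l} (j<l : j Fin.< l) → incoming j (c j<l) ≡ zero
  incoming-source {j} j<l with Fin.any? (incoming-from? j (c j<l))
  ... | yes (i , i<j , c≡) = ⊥-elim (proper i<j j<l c≡)
  ... | no _               = refl

  no-collision : ¬ (2 ^ k < n)
  no-collision 2^k<n with Fin.pigeonhole 2^k<n (Fin.funToFin ∘ incoming)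
  ... | j , l , j<l , same-code
    with trans (sym (incoming-source j<l))
           (trans (funToFin-injective same-code (c j<l)) (incoming-target j<l))
  ... | ()

colourable⇒≤2^ : ∀ {n k} → Colorable n k → n ≤ 2 ^ k
colourable⇒≤2^ (c , proper) =
  shift-colouring-bound (c ∘ shiftVertex) λ i<j j<l → proper _ _ (shiftVertex-adjacent i<j j<l)

⊈⇒∃∈∉ : ∀ {m} {p q : Subset m} → p ⊈ q → ∃ λ x → x ∈ p × x ∉ q
⊈⇒∃∈∉ {p = p} {q} p⊈q with Fin.any? (λ x → (x ∈? p) ×-dec ¬? (x ∈? q))
... | yes witness = witness
... | no ¬witness =
  ⊥-elim (p⊈q λ {x} x∈p → decidable-stable (x ∈? q) λ x∉q → ¬witness (x , x∈p , x∉q))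

∣∣≡∧≢⇒⊈ : ∀ {m} {p q : Subset m} → ∣ p ∣ ≡ ∣ q ∣ → p ≢ q → p ⊈ q
∣∣≡∧≢⇒⊈ {p = p} {q} ∣p∣≡∣q∣ p≢q p⊆q with q ⊆? p
... | yes q⊆p = p≢q (⊆-antisym p⊆q q⊆p)
... | no q⊈p  = ℕ.<-irrefl ∣p∣≡∣q∣ (p⊂q⇒∣p∣<∣q∣ (p⊆q , ⊈⇒∃∈∉ q⊈p))

splitAt-cast-injective : ∀ {k} m {n} (k≡m+n : k ≡ m + n) {i j : Fin k} →
                         Fin.splitAt m (Fin.cast k≡m+n i) ≡ Fin.splitAt m (Fin.cast k≡m+n j) → i ≡ j
splitAt-cast-injective m {n} k≡m+n {i} {j} same-split = begin
  i                                           ≡⟨ Fin.cast-involutive (sym k≡m+n) k≡m+n i ⟨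
  back (to i)                                 ≡⟨ cong back (Fin.join-splitAt m n (to i)) ⟨
  back (Fin.join m n (Fin.splitAt m (to i)))  ≡⟨ cong (back ∘ Fin.join m n) same-split ⟩
  back (Fin.join m n (Fin.splitAt m (to j)))  ≡⟨ cong back (Fin.join-splitAt m n (to j)) ⟩
  back (to j)                                 ≡⟨ Fin.cast-involutive (sym k≡m+n) k≡m+n j ⟩
  j                                           ∎
  where
  open ≡-Reasoning
  to   = Fin.cast k≡m+n
  back = Fin.cast (sym k≡m+n)

ofSize : ∀ m w → Fin (m C w) → Subset m
ofSize zero    zero    _ = []
ofSize (suc m) zero    _ = ∅
ofSize (suc m) (suc w) =
  [ (inside ∷_) ∘ ofSize m w , (outside ∷_) ∘ ofSize m (suc w) ]′
  ∘ Fin.splitAt (m C w) ∘ Fin.cast (sym (nCk+nC[k+1]≡[n+1]C[k+1] m w))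

∣ofSize∣ : ∀ m w (i : Fin (m C w)) → ∣ ofSize m w i ∣ ≡ w
∣ofSize∣ zero    zero    _ = refl
∣ofSize∣ (suc m) zero    _ = ∣⊥∣≡0 (suc m)
∣ofSize∣ (suc m) (suc w) i with Fin.splitAt (m C w) (Fin.cast (sym (nCk+nC[k+1]≡[n+1]C[k+1] m w)) i)
... | inj₁ a = cong suc (∣ofSize∣ m w a)
... | inj₂ b = ∣ofSize∣ m (suc w) b

ofSize-injective : ∀ m w {i j : Fin (m C w)} → ofSize m w i ≡ ofSize m w j → i ≡ j
ofSize-injective zero    zero    {zero} {zero} _ = refl
ofSize-injective (suc m) zero    {zero} {zero} _ = refl
ofSize-injective (suc m) (suc w) same =
  splitAt-cast-injective (m C w) (sym (nCk+nC[k+1]≡[n+1]C[k+1] m w)) (split-injective _ _ same)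
  where
  split-injective : ∀ a b → [ (inside ∷_) ∘ ofSize m w , (outside ∷_) ∘ ofSize m (suc w) ]′ a
                          ≡ [ (inside ∷_) ∘ ofSize m w , (outside ∷_) ∘ ofSize m (suc w) ]′ b → a ≡ b
  split-injective (inj₁ a) (inj₁ b) same = cong inj₁ (ofSize-injective m w (∷-injectiveʳ same))
  split-injective (inj₂ a) (inj₂ b) same = cong inj₂ (ofSize-injective m (suc w) (∷-injectiveʳ same))

antichain⇒colourable : ∀ {n m} (A : Fin n → Subset m) →
                       (∀ {i j} → i ≢ j → ∃ λ x → x ∈ A i × x ∉ A j) →
                       Colorable n (2 + m)
antichain⇒colourable {n} {m} A separated = proj₁ ∘ fitting , proper
  where
  A⁺ : Fin n → Subset (2 + m)
  A⁺ i = inside ∷ outside ∷ A i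

  Fits : (Fin n → ℤ) → Fin (2 + m) → Set
  Fits v x = ∀ i → (v i ≡ 1ℤ → x ∈ A⁺ i) × (v i ≡ -1ℤ → x ∉ A⁺ i)

  fits-separating : ∀ {v i j x} → (∀ k → v k ≡ 1ℤ → k ≡ i) → (∀ k → v k ≡ -1ℤ → k ≡ j) →
                    x ∈ A i → x ∉ A j → Fits v (suc (suc x))
  fits-separating {x = x} positive negative x∈Ai x∉Aj k =
    (λ vk≡1 → subst (λ k → suc (suc x) ∈ A⁺ k) (sym (positive k vk≡1)) (there (there x∈Ai))) ,
    λ { vk≡-1 (there (there x∈Ak)) → x∉Aj (subst (λ k → x ∈ A k) (negative k vk≡-1) x∈Ak) }

  fitting : (u : Vertex n) → ∃ (Fits (proj₁ u))
  fitting (v , isVertex) with Fin.any? (λ j → v j ℤ.≟ -1ℤ) | Fin.any? (λ i → v i ℤ.≟ 1ℤ)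
  ... | no ¬negative | _ =
    zero , λ i → (λ _ → here) , (λ vi≡-1 → ⊥-elim (¬negative (i , vi≡-1)))
  ... | yes _ | no ¬positive =
    suc zero , λ i → (λ vi≡1 → ⊥-elim (¬positive (i , vi≡1))) , λ { _ (there ()) }
  ... | yes (j , vj≡-1) | yes (i , vi≡1)
    with separated {i} {j} (λ { refl → ≡1⇒≢-1 vi≡1 vj≡-1 })
  ... | x , x∈Ai , x∉Aj =
    suc (suc x) , uncurry fits-separating (vertex-signs isVertex vi≡1 vj≡-1) x∈Ai x∉Aj

  proper : ∀ u v → Adj u v → proj₁ (fitting u) ≢ proj₁ (fitting v)
  proper (u , u-vertex) (v , v-vertex) u·v≡-1 same
    with dot≡-1⇒opposite u v (proj₁ u-vertex) (proj₁ v-vertex) u·v≡-1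
  ... | i , inj₁ (ui≡1 , vi≡-1) =
    proj₂ (proj₂ (fitting (v , v-vertex)) i) vi≡-1
      (subst (_∈ A⁺ i) same (proj₁ (proj₂ (fitting (u , u-vertex)) i) ui≡1))
  ... | i , inj₂ (ui≡-1 , vi≡1) =
    proj₂ (proj₂ (fitting (u , u-vertex)) i) ui≡-1
      (subst (_∈ A⁺ i) (sym same) (proj₁ (proj₂ (fitting (v , v-vertex)) i) vi≡1))

≤C⇒colourable : ∀ {n} m w → n ≤ m C w → Colorable n (2 + m)
≤C⇒colourable {n} m w n≤mCw = antichain⇒colourable A separated
  where
  A : Fin n → Subset m
  A i = ofSize m w (Fin.inject≤ i n≤mCw)

  separated : ∀ {i j} → i ≢ j → ∃ λ x → x ∈ A i × x ∉ A j
  separated {i} {j} i≢j = ⊈⇒∃∈∉ (∣∣≡∧≢⇒⊈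
    (trans (∣ofSize∣ m w _) (sym (∣ofSize∣ m w _)))
    (i≢j ∘ Fin.inject≤-injective n≤mCw n≤mCw i j ∘ ofSize-injective m w))

C-absorption : ∀ n k → suc k * (suc n C suc k) ≡ suc n * (n C k)
C-absorption zero    zero    = refl
C-absorption zero    (suc k) = ℕ.*-zeroʳ (suc (suc k))
C-absorption (suc n) k       = begin
  suc k * (suc (suc n) C suc k)
    ≡⟨ cong (suc k *_) (nCk+nC[k+1]≡[n+1]C[k+1] (suc n) k) ⟨
  suc k * (suc n C k + suc n C suc k)
    ≡⟨ ℕ.*-distribˡ-+ (suc k) (suc n C k) _ ⟩
  suc k * (suc n C k) + suc k * (suc n C suc k)
    ≡⟨ cong (suc k * (suc n C k) +_) (C-absorption n k) ⟩
  suc k * (suc n C k) + suc n * (n C k)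
    ≡⟨ ℕ.+-assoc (suc n C k) (k * (suc n C k)) _ ⟩
  suc n C k + (k * (suc n C k) + suc n * (n C k))
    ≡⟨ cong (suc n C k +_) (shifted k) ⟩
  suc (suc n) * (suc n C k)
    ∎
  where
  open ≡-Reasoning
  shifted : ∀ k → k * (suc n C k) + suc n * (n C k) ≡ suc n * (suc n C k)
  shifted zero    = refl
  shifted (suc k) = begin
    suc k * (suc n C suc k) + suc n * (n C suc k) ≡⟨ cong (_+ suc n * (n C suc k)) (C-absorption n k) ⟩
    suc n * (n C k) + suc n * (n C suc k)         ≡⟨ ℕ.*-distribˡ-+ (suc n) (n C k) _ ⟨
    suc n * (n C k + n C suc k)                   ≡⟨ cong (suc n *_) (nCk+nC[k+1]≡[n+1]C[k+1] n k) ⟩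
    suc n * (suc n C suc k)                       ∎

central : ℕ → ℕ
central s = (s + s) C s

central-ratio : ∀ s → suc s * central (suc s) ≡ 2 * suc (s + s) * central s
central-ratio s = begin
  suc s * (suc (s + suc s) C suc s)         ≡⟨ cong (λ m → suc s * (suc m C suc s)) (ℕ.+-suc s s) ⟩
  suc s * (suc (suc (s + s)) C suc s)       ≡⟨ C-absorption (suc (s + s)) s ⟩
  suc (suc (s + s)) * (suc (s + s) C s)     ≡⟨ cong (suc (suc (s + s)) *_) symmetric ⟩
  suc (suc (s + s)) * (suc (s + s) C suc s) ≡⟨ regroup s (suc (s + s) C suc s) ⟩
  2 * (suc s * (suc (s + s) C suc s))       ≡⟨ cong (2 *_) (C-absorption (s + s) s) ⟩
  2 * (suc (s + s) * central s)             ≡⟨ ℕ.*-assoc 2 (suc (s + s)) (central s) ⟨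
  2 * suc (s + s) * central s               ∎
  where
  open ≡-Reasoning
  symmetric : suc (s + s) C s ≡ suc (s + s) C suc s
  symmetric = trans (nCk≡nC[n∸k] (ℕ.m≤n⇒m≤1+n (ℕ.m≤m+n s s)))
                    (cong (suc (s + s) C_) (ℕ.m+n∸n≡m (suc s) s))

  regroup : ∀ s x → suc (suc (s + s)) * x ≡ 2 * (suc s * x)
  regroup = solve-∀

central-double : ∀ s → 2 * central s ≤ central (suc s)
central-double s = ℕ.*-cancelˡ-≤ (suc s) (begin
  suc s * (2 * central s)     ≡⟨ commute s (central s) ⟩
  2 * suc s * central s       ≤⟨ ℕ.*-monoˡ-≤ (central s) (ℕ.*-monoʳ-≤ 2 (s≤s (ℕ.m≤m+n s s))) ⟩
  2 * suc (s + s) * central s ≡⟨ central-ratio s ⟨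
  suc s * central (suc s)     ∎)
  where
  open ℕ.≤-Reasoning
  commute : ∀ s x → suc s * (2 * x) ≡ 2 * suc s * x
  commute = solve-∀

2^≤central : ∀ s → 2 ^ s ≤ central s
2^≤central zero    = ℕ.≤-refl
2^≤central (suc s) = ℕ.≤-trans (ℕ.*-monoʳ-≤ 2 (2^≤central s)) (central-double s)

-- The ratio identity gives ((t+1) c(t+1))² = 4 (2t+1)² c(t)² ≥ 16 t (t+1) c(t)², so
-- 4t · c(t)² / 16^t never decreases from its value 1 at t = 1: c(t) ≥ 4^t / (2√t).
central-square-lower : ∀ t → 1 ≤ t → 16 ^ t ≤ 4 * t * (central t * central t)
central-square-lower (suc zero)    _ = ℕ.≤-refl
central-square-lower (suc (suc s)) _ = ℕ.*-cancelˡ-≤ (suc t) (begin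
  suc t * (16 * 16 ^ t)
    ≡⟨ commute t (16 ^ t) ⟩
  16 * (suc t * 16 ^ t)
    ≤⟨ ℕ.*-monoʳ-≤ 16 (ℕ.*-monoʳ-≤ (suc t) (central-square-lower (suc s) (s≤s z≤n))) ⟩
  16 * (suc t * (4 * t * (c * c)))
    ≤⟨ ℕ.m≤m+n _ (16 * c * c) ⟩
  16 * (suc t * (4 * t * (c * c))) + 16 * c * c
    ≡⟨ expand t c ⟨
  4 * (2 * suc (t + t) * c) * (2 * suc (t + t) * c)
    ≡⟨ cong (λ x → 4 * x * x) (central-ratio t) ⟨
  4 * (suc t * c′) * (suc t * c′)
    ≡⟨ factor t c′ ⟩
  suc t * (4 * suc t * (c′ * c′))
    ∎)
  where
  open ℕ.≤-Reasoning
  t  = suc s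
  c  = central t
  c′ = central (suc t)

  commute : ∀ t x → suc t * (16 * x) ≡ 16 * (suc t * x)
  commute = solve-∀

  expand : ∀ t c → 4 * (2 * suc (t + t) * c) * (2 * suc (t + t) * c) ≡ 16 * (suc t * (4 * t * (c * c))) + 16 * c * c
  expand = solve-∀

  factor : ∀ t c → 4 * (suc t * c) * (suc t * c) ≡ suc t * (4 * suc t * (c * c))
  factor = solve-∀

n<2^n : ∀ n → n < 2 ^ n
n<2^n zero    = s≤s z≤n
n<2^n (suc n) = ℕ.+-mono-≤ (ℕ.m^n>0 2 n) (ℕ.≤-trans (n<2^n n) (ℕ.m≤m+n (2 ^ n) 0))

n≤central[m+n] : ∀ m n → n ≤ central (m + n)
n≤central[m+n] m n =
  ℕ.≤-trans (ℕ.<⇒≤ (n<2^n n)) (ℕ.≤-trans (ℕ.^-monoʳ-≤ 2 (ℕ.m≤n+m n m)) (2^≤central (m + n)))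

^-distribʳ-* : ∀ x y q → (x * y) ^ q ≡ x ^ q * y ^ q
^-distribʳ-* x y zero    = refl
^-distribʳ-* x y (suc q) = begin
  x * y * (x * y) ^ q         ≡⟨ cong (x * y *_) (^-distribʳ-* x y q) ⟩
  x * y * (x ^ q * y ^ q)     ≡⟨ interchange x y (x ^ q) (y ^ q) ⟩
  x * x ^ q * (y * y ^ q)     ∎
  where
  open ≡-Reasoning
  interchange : ∀ x y a b → x * y * (a * b) ≡ x * a * (y * b)
  interchange = solve-∀

^-2*≡square^ : ∀ x q → x ^ (2 * q) ≡ (x * x) ^ q
^-2*≡square^ x q = trans (sym (ℕ.^-*-assoc x 2 q)) (cong (λ y → (x * y) ^ q) (ℕ.*-identityʳ x))

m≤m^[1+n] : ∀ m n → m ≤ m ^ suc n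
m≤m^[1+n] zero    n = z≤n
m≤m^[1+n] (suc m) n = ℕ.m≤m*n (suc m) (suc m ^ n) {{ℕ.m^n≢0 (suc m) n}}

crossing : ∀ (f : ℕ → ℕ) {n} t fuel → f t < n → n ≤ f (t + fuel) →
           ∃ λ s → t ≤ s × f s < n × n ≤ f (suc s)
crossing f {n} t zero ft<n n≤f[t+0] =
  ⊥-elim (ℕ.<⇒≱ ft<n (subst (λ s → n ≤ f s) (ℕ.+-identityʳ t) n≤f[t+0]))
crossing f {n} t (suc fuel) ft<n n≤f[t+1+fuel] with n ℕ.≤? f (suc t)
... | yes n≤f[1+t] = t , ℕ.≤-refl , ft<n , n≤f[1+t]
... | no n≰f[1+t]
  with crossing f (suc t) fuel (ℕ.≰⇒> n≰f[1+t]) (subst (λ s → n ≤ f s) (ℕ.+-suc t fuel) n≤f[t+1+fuel])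
... | s , 1+t≤s , fs<n , n≤f[1+s] = s , ℕ.≤-trans (ℕ.n≤1+n t) 1+t≤s , fs<n , n≤f[1+s]

UpperBound-antitone : ∀ {n k k′ a b} → k ≤ k′ → UpperBound n k′ a b → UpperBound n k a b
UpperBound-antitone {a = a} {b} k≤k′ bound m d 1≤d below =
  bound m d 1≤d (ℕ.<-≤-trans below (ℕ.*-monoˡ-≤ (d ^ a) (ℕ.^-monoʳ-≤ 2 (ℕ.*-monoˡ-≤ b k≤k′))))

-- T² ≤ 1024 t n² raised to the power q, multiplied out against d^(q + r + 1):
-- the factor t^q d^q is absorbed by m^q, and 1024^q d^(r+1) by m^(r+1).
power-estimate : ∀ {T t n m d} q r → T * T ≤ 1024 * (t * (n * n)) → t * d ≤ m → 1024 ^ q * d ≤ m →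
                 (T * T) ^ q * d ^ (q + suc r) ≤ m ^ (q + suc r) * (n * n) ^ q
power-estimate {T} {t} {n} {m} {d} q r T²≤ td≤m Kd≤m = begin
  (T * T) ^ q * d ^ (q + suc r)
    ≤⟨ ℕ.*-monoˡ-≤ _ (ℕ.^-monoˡ-≤ q T²≤) ⟩
  (1024 * (t * (n * n))) ^ q * d ^ (q + suc r)
    ≡⟨ cong₂ _*_ (trans (^-distribʳ-* 1024 _ q) (cong (1024 ^ q *_) (^-distribʳ-* t (n * n) q)))
                 (ℕ.^-distribˡ-+-* d q (suc r)) ⟩
  1024 ^ q * (t ^ q * (n * n) ^ q) * (d ^ q * d ^ suc r)
    ≡⟨ regroup (1024 ^ q) (t ^ q) ((n * n) ^ q) (d ^ q) (d ^ suc r) ⟩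
  t ^ q * d ^ q * (1024 ^ q * d ^ suc r) * (n * n) ^ q
    ≡⟨ cong (λ x → x * (1024 ^ q * d ^ suc r) * (n * n) ^ q) (^-distribʳ-* t d q) ⟨
  (t * d) ^ q * (1024 ^ q * d ^ suc r) * (n * n) ^ q
    ≤⟨ ℕ.*-monoˡ-≤ ((n * n) ^ q) (ℕ.*-mono-≤ (ℕ.^-monoˡ-≤ q td≤m) Kd^[1+r]≤m^[1+r]) ⟩
  m ^ q * m ^ suc r * (n * n) ^ q
    ≡⟨ cong (_* (n * n) ^ q) (ℕ.^-distribˡ-+-* m q (suc r)) ⟨
  m ^ (q + suc r) * (n * n) ^ q
    ∎
  where
  open ℕ.≤-Reasoning
  regroup : ∀ k a b x y → k * (a * b) * (x * y) ≡ a * x * (k * y) * b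
  regroup = solve-∀

  Kd^[1+r]≤m^[1+r] : 1024 ^ q * d ^ suc r ≤ m ^ suc r
  Kd^[1+r]≤m^[1+r] = begin
    1024 ^ q * d ^ suc r             ≤⟨ ℕ.*-monoˡ-≤ (d ^ suc r) (m≤m^[1+n] (1024 ^ q) r) ⟩
    (1024 ^ q) ^ suc r * d ^ suc r   ≡⟨ ^-distribʳ-* (1024 ^ q) d (suc r) ⟨
    (1024 ^ q * d) ^ suc r           ≤⟨ ℕ.^-monoˡ-≤ (suc r) Kd≤m ⟩
    m ^ suc r                        ∎

central<⇒UpperBound : ∀ {n t} p q → 1024 ^ q ≤ t → central t < n →
                    UpperBound n (2 + (suc t + suc t)) (q + 2 * suc p) (2 * q)
central<⇒UpperBound {n} {t} p q K≤t ct<n m d _ below with 2 ^ m ℕ.≤? n ^ d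
... | yes 2^m≤n^d = 2^m≤n^d
... | no 2^m≰n^d  = contradiction below (ℕ.≤⇒≯ bound)
  where
  open ℕ.≤-Reasoning
  M = 2 + (suc t + suc t)

  td<m : t * d < m
  td<m = ℕ.≰⇒> λ m≤td → 2^m≰n^d (begin
    2 ^ m       ≤⟨ ℕ.^-monoʳ-≤ 2 m≤td ⟩
    2 ^ (t * d) ≡⟨ ℕ.^-*-assoc 2 t d ⟨
    (2 ^ t) ^ d ≤⟨ ℕ.^-monoˡ-≤ d (ℕ.≤-trans (2^≤central t) (ℕ.<⇒≤ ct<n)) ⟩
    n ^ d       ∎)

  exponent : ∀ t → (2 + (suc t + suc t)) + (2 + (suc t + suc t)) ≡ 8 + 4 * t
  exponent = solve-∀

  scale : ∀ t x → 256 * (4 * t * x) ≡ 1024 * (t * x)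
  scale = solve-∀

  T²≤ : 2 ^ M * 2 ^ M ≤ 1024 * (t * (n * n))
  T²≤ = begin
    2 ^ M * 2 ^ M
      ≡⟨ ℕ.^-distribˡ-+-* 2 M M ⟨
    2 ^ (M + M)
      ≡⟨ cong (2 ^_) (exponent t) ⟩
    2 ^ (8 + 4 * t)
      ≡⟨ ℕ.^-distribˡ-+-* 2 8 (4 * t) ⟩
    256 * 2 ^ (4 * t)
      ≡⟨ cong (256 *_) (ℕ.^-*-assoc 2 4 t) ⟨
    256 * 16 ^ t
      ≤⟨ ℕ.*-monoʳ-≤ 256 (central-square-lower t (ℕ.≤-trans (ℕ.m^n>0 1024 q) K≤t)) ⟩
    256 * (4 * t * (central t * central t))
      ≤⟨ ℕ.*-monoʳ-≤ 256 (ℕ.*-monoʳ-≤ (4 * t) (ℕ.*-mono-≤ (ℕ.<⇒≤ ct<n) (ℕ.<⇒≤ ct<n))) ⟩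
    256 * (4 * t * (n * n))
      ≡⟨ scale t (n * n) ⟩
    1024 * (t * (n * n))
      ∎

  bound : 2 ^ (M * (2 * q)) * d ^ (q + 2 * suc p) ≤ m ^ (q + 2 * suc p) * n ^ (2 * q)
  bound = begin
    2 ^ (M * (2 * q)) * d ^ (q + 2 * suc p)
      ≡⟨ cong (_* d ^ (q + 2 * suc p)) (trans (sym (ℕ.^-*-assoc 2 M (2 * q))) (^-2*≡square^ (2 ^ M) q)) ⟩
    (2 ^ M * 2 ^ M) ^ q * d ^ (q + 2 * suc p)
      ≤⟨ power-estimate {2 ^ M} {t} {n} q _ T²≤ (ℕ.<⇒≤ td<m)
                        (ℕ.≤-trans (ℕ.*-monoˡ-≤ d K≤t) (ℕ.<⇒≤ td<m)) ⟩
    m ^ (q + 2 * suc p) * (n * n) ^ q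
      ≡⟨ cong (m ^ (q + 2 * suc p) *_) (^-2*≡square^ n q) ⟨
    m ^ (q + 2 * suc p) * n ^ (2 * q)
      ∎

theorem1 : ((n k : ℕ) → 2 ≤ n → IsChromaticNumber n k → n ≤ 2 ^ k)
    × ((p q : ℕ) → 1 ≤ p → 1 ≤ q →
    ∃[ N ] ((n k : ℕ) → N ≤ n → 2 ≤ n → IsChromaticNumber n k →
    UpperBound n k (q + 2 * p) (2 * q)))
theorem1 = (λ n k _ (colourable , _) → colourable⇒≤2^ colourable) , upper
  where
  upper : (p q : ℕ) → 1 ≤ p → 1 ≤ q →
          ∃[ N ] ((n k : ℕ) → N ≤ n → 2 ≤ n → IsChromaticNumber n k →
                  UpperBound n k (q + 2 * p) (2 * q))
  upper (suc p) q _ _ = suc (central K) , bound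
    where
    K = 1024 ^ q
    bound : (n k : ℕ) → suc (central K) ≤ n → 2 ≤ n → IsChromaticNumber n k →
            UpperBound n k (q + 2 * suc p) (2 * q)
    bound n k cK<n _ (_ , minimal) with crossing central K n cK<n (n≤central[m+n] K n)
    ... | t , K≤t , ct<n , n≤ct′ =
      UpperBound-antitone {a = q + 2 * suc p}
        (minimal _ (≤C⇒colourable (suc t + suc t) (suc t) n≤ct′))
        (central<⇒UpperBound p q K≤t ct<n)
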